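{- For every weighted signed graph $(G,\omega)$ we have $g_{01}({\rm EDC}(G,\omega))=g_{01}(G,\omega)$, $g_{10}({\rm EDC}(G,\omega))=g_{11}(G,\omega)+1$, and $g_{11}({\rm EDC}(G,\omega))=g_{10}(G,\omega)+1$ (with $\infty+1=\infty$).
   Context: A weighted signed graph $(G,\omega)$ is a graph $G$ with an assignment $\omega$ of weights in $\{\pm1,\pm2,\dots,\pm k\}$ (for some integer $k$) to its edges. The length of a walk is the sum of the absolute values of the weights of its edges, and its sign is the product of the signs of the weights of its edges (with multiplicity). A closed walk has type $ij\in\mathbb{Z}_2^2$ where $i=0$ if it is positive and $i=1$ if negative, and $j$ is the parity of its length; $g_{ij}(G,\omega)$ is the minimum length of a closed walk of type $ij$ ($\infty$ if none). The Extended Double Cover ${\rm EDC}(G,\omega)$ is the weighted signed graph on vertex set $\{v^+,v^-:v\in V(G)\}$ where $x^+$ and $x^-$ are joined by an edge of weight $-1$ for each vertex $x$, and for each edge $xy$ of $G$ there are four edges $x^+y^+,x^+y^-,x^-y^+,x^-y^-$ weighted as follows: if $\omega(xy)=p>0$, then $x^+y^+$ and $x^-y^-$ have weight $p$ and $x^+y^-$, $x^-y^+$ have weight $-(p+1)$; if $\omega(xy)=-p<0$, then $x^+y^-$ and $x^-y^+$ have weight $p$ and $x^+y^+$, $x^-y^-$ have weight $-(p+1)$. -}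

module Defs where

open import Data.Bool using (Bool; true; false; _xor_)
open import Data.Nat using (ℕ; zero; suc; _+_; _≤_)
open import Data.Integer using (ℤ; +_; -_; -[1+_]; ∣_∣; _<_; _≟_)
open import Data.Fin using (Fin)
open import Data.List using (List; []; _∷_; map; concatMap; _++_; allFin)
open import Data.List.Membership.Propositional using (_∈_)
open import Data.List.Relation.Unary.All using (All)
open import Data.Product using (_×_; _,_; ∃; Σ)
open import Data.Maybe using (Maybe; just; nothing)
open import Relation.Nullary using (¬_; does)
open import Relation.Binary.PropositionalEquality using (_≡_)

-- A weighted signed graph on vertex type V: a (multi)set of edges, each given
-- by its two endpoints and its (nonzero) integer weight.
Edge : Set → Set
Edge V = V × V × ℤ

WSG : Set → Set
WSG V = List (Edge V)

ValidWeights : {V : Set} → WSG V → Set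
ValidWeights E = All (λ { (x , y , w) → ¬ (w ≡ + 0) }) E

negW : ℤ → Bool
negW w = does (w Data.Integer.<? + 0)

data Walk {V : Set} (E : WSG V) : V → V → Set where
  [] : ∀ {x} → Walk E x x
  fwd : ∀ {x y z w} → (x , y , w) ∈ E → Walk E y z → Walk E x z
  bwd : ∀ {x y z w} → (y , x , w) ∈ E → Walk E y z → Walk E x z

len : ∀ {V} {E : WSG V} {x y} → Walk E x y → ℕ
len [] = 0
len (fwd {w = w} _ p) = ∣ w ∣ + len p
len (bwd {w = w} _ p) = ∣ w ∣ + len p

neg : ∀ {V} {E : WSG V} {x y} → Walk E x y → Bool
neg [] = false
neg (fwd {w = w} _ p) = negW w xor neg p
neg (bwd {w = w} _ p) = negW w xor neg p

odd : ℕ → Bool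
odd zero = false
odd (suc n) = Data.Bool.not (odd n)

-- type ij of a closed walk: i = true iff negative, j = true iff odd length
Type : Set
Type = Bool × Bool

type : ∀ {V} {E : WSG V} {x y} → Walk E x y → Type
type p = neg p , odd (len p)

HasClosedWalk : ∀ {V} → WSG V → Type → ℕ → Set
HasClosedWalk {V} E t m = Σ V λ x → Σ (Walk E x x) λ p → type p ≡ t × len p ≡ m

-- g_t(E) = v, where v : Maybe ℕ and nothing stands for ∞
IsG : ∀ {V} → WSG V → Type → Maybe ℕ → Set
IsG {V} E t (just m) =
  HasClosedWalk E t m × (∀ x (p : Walk E x x) → type p ≡ t → m ≤ len p)
IsG {V} E t nothing = ∀ x (p : Walk E x x) → ¬ (type p ≡ t)

suc∞ : Maybe ℕ → Maybe ℕ
suc∞ (just m) = just (suc m)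
suc∞ nothing = nothing

-- The Extended Double Cover. Vertex (v , true) is v⁺, (v , false) is v⁻.
edcEdges : ∀ {n} → Edge (Fin n) → WSG (Fin n × Bool)
edcEdges (x , y , w) with negW w
... | false =
  ((x , true) , (y , true) , w) ∷ ((x , false) , (y , false) , w) ∷
  ((x , true) , (y , false) , - (w Data.Integer.+ + 1)) ∷
  ((x , false) , (y , true) , - (w Data.Integer.+ + 1)) ∷ []
... | true =
  ((x , true) , (y , false) , - w) ∷ ((x , false) , (y , true) , - w) ∷
  ((x , true) , (y , true) , w Data.Integer.- + 1) ∷
  ((x , false) , (y , false) , w Data.Integer.- + 1) ∷ []

EDC : ∀ {n} → WSG (Fin n) → WSG (Fin n × Bool)
EDC {n} E =
  map (λ x → ((x , true) , (x , false) , -[1+ 0 ])) (allFin n)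
  ++ concatMap edcEdges E

{-# OPTIONS --safe #-}
-- Walks of EDC(G) project to walks of G (x± ↦ x) and walks of G lift to EDC(G).
-- An edge of EDC(G) over an edge of weight w is one unit longer than |w| exactly when
-- it is negative, and a rung x⁺x⁻ is negative of length 1; so a walk q projects to a
-- walk p with len q = len p + k, where k, the number of negative edges of q, has the
-- parity of the sign of q, and for closed q the signs of p and q agree. Conversely the
-- positive edges of EDC(G) lift p with its length, to a walk returning to the same
-- layer iff p is positive; a negative one is closed up by a rung at cost 1. Hence
-- closed walks of type (s , j) in G match closed walks of type (s , j + s) in EDC(G),
-- their minimal lengths differing by s.
module Submission where

open import Defs
open import Data.Nat using (ℕ)
open import Data.Fin using (Fin)
open import Data.Bool using (true; false)
open import Data.Maybe using (Maybe)
open import Data.Product using (_×_; _,_)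
open import Function.Bundles using (_⇔_)

open import Algebra.Bundles using (CommutativeRing)
open import Data.Bool using (Bool; not; _xor_)
open import Data.Bool.Properties
  using (xor-assoc; xor-comm; xor-same; xor-identityʳ; not-distribˡ-xor; xor-∧-commutativeRing)
open import Data.Nat using (zero; suc; _+_; _≤_; z≤n; s≤s)
open import Data.Nat.Properties
  using ( ≤-reflexive; ≤-trans; ≤-antisym; +-identityʳ; +-assoc; +-comm
        ; +-monoˡ-≤; +-monoʳ-≤; +-cancelˡ-≤; +-commutativeSemigroup)
open import Data.Integer as ℤ using (ℤ; +_; -[1+_]; ∣_∣)
open import Data.List using (map; allFin)
open import Data.List.Membership.Propositional using (_∈_; find; lose)
open import Data.List.Membership.Propositional.Properties
  using ( ∈-++⁺ˡ; ∈-++⁺ʳ; ∈-++⁻; ∈-map⁺; ∈-map⁻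
        ; ∈-concatMap⁺; ∈-concatMap⁻; ∈-allFin)
open import Data.List.Relation.Unary.Any using (here; there)
open import Data.Maybe using (just; nothing)
import Data.Maybe as Maybe
open import Data.Product using (Σ-syntax; proj₁; proj₂)
open import Data.Sum using (inj₁; inj₂)
open import Function.Bundles using (mk⇔)
open import Relation.Binary.PropositionalEquality
  using (_≡_; refl; sym; trans; cong; cong₂; module ≡-Reasoning)

open import Algebra.Properties.CommutativeSemigroup
  (CommutativeRing.+-commutativeSemigroup xor-∧-commutativeRing)
  using () renaming (interchange to xor-interchange)
open import Algebra.Properties.CommutativeSemigroup +-commutativeSemigroup
  using () renaming (interchange to +-interchange)

toℕ : Bool → ℕ
toℕ false = 0
toℕ true  = 1

xor-cancelʳ : ∀ b t → (b xor t) xor t ≡ b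
xor-cancelʳ b t = begin
  (b xor t) xor t  ≡⟨ xor-assoc b t t ⟩
  b xor (t xor t)  ≡⟨ cong (b xor_) (xor-same t) ⟩
  b xor false      ≡⟨ xor-identityʳ b ⟩
  b                ∎
  where open ≡-Reasoning

xor-injectiveˡ : ∀ {a b} t → a xor t ≡ b xor t → a ≡ b
xor-injectiveˡ {a} {b} t eq = begin
  a                ≡⟨ sym (xor-cancelʳ a t) ⟩
  (a xor t) xor t  ≡⟨ cong (_xor t) eq ⟩
  (b xor t) xor t  ≡⟨ xor-cancelʳ b t ⟩
  b                ∎
  where open ≡-Reasoning

xor-identityʳ-unique : ∀ {b} t → b ≡ b xor t → t ≡ false
xor-identityʳ-unique {b} t eq = begin
  t                ≡⟨ sym (xor-cancelʳ t b) ⟩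
  (t xor b) xor b  ≡⟨ cong (_xor b) (xor-comm t b) ⟩
  (b xor t) xor b  ≡⟨ cong (_xor b) (sym eq) ⟩
  b xor b          ≡⟨ xor-same b ⟩
  false            ∎
  where open ≡-Reasoning

xor≡false⇒≡ : ∀ {a b} → a xor b ≡ false → a ≡ b
xor≡false⇒≡ {b = b} eq = xor-injectiveˡ b (trans eq (sym (xor-same b)))

odd-+ : ∀ m n → odd (m + n) ≡ odd m xor odd n
odd-+ zero    n = refl
odd-+ (suc m) n = trans (cong not (odd-+ m n)) (not-distribˡ-xor (odd m) (odd n))

odd-toℕ : ∀ b → odd (toℕ b) ≡ b
odd-toℕ false = refl
odd-toℕ true  = refl

odd⇒toℕ≤ : ∀ {k s} → odd k ≡ s → toℕ s ≤ k
odd⇒toℕ≤ {s = false}          _  = z≤n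
odd⇒toℕ≤ {k = zero}  {true}  ()
odd⇒toℕ≤ {k = suc _} {true}  _  = s≤s z≤n

odd-shift : ∀ k n {s} → odd k ≡ s → odd (k + n) ≡ odd n xor s
odd-shift k n {s} odd-k = begin
  odd (k + n)          ≡⟨ odd-+ k n ⟩
  odd k xor odd n      ≡⟨ cong (_xor odd n) odd-k ⟩
  s xor odd n          ≡⟨ xor-comm s (odd n) ⟩
  odd n xor s          ∎
  where open ≡-Reasoning

module _ {V : Set} {E : WSG V} where

  infixr 5 _++ʷ_

  _++ʷ_ : ∀ {x y z} → Walk E x y → Walk E y z → Walk E x z
  []      ++ʷ q = q
  fwd e p ++ʷ q = fwd e (p ++ʷ q)
  bwd e p ++ʷ q = bwd e (p ++ʷ q)

  negatives : ∀ {x y} → Walk E x y → ℕ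
  negatives []                = 0
  negatives (fwd {w = w} _ p) = toℕ (negW w) + negatives p
  negatives (bwd {w = w} _ p) = toℕ (negW w) + negatives p

  len-++ʷ : ∀ {x y z} (p : Walk E x y) (q : Walk E y z) → len (p ++ʷ q) ≡ len p + len q
  len-++ʷ []                q = refl
  len-++ʷ (fwd {w = w} _ p) q =
    trans (cong (_+_ ∣ w ∣) (len-++ʷ p q)) (sym (+-assoc ∣ w ∣ _ _))
  len-++ʷ (bwd {w = w} _ p) q =
    trans (cong (_+_ ∣ w ∣) (len-++ʷ p q)) (sym (+-assoc ∣ w ∣ _ _))

  negatives-++ʷ : ∀ {x y z} (p : Walk E x y) (q : Walk E y z) →
    negatives (p ++ʷ q) ≡ negatives p + negatives q
  negatives-++ʷ []                q = refl
  negatives-++ʷ (fwd {w = w} _ p) q =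
    trans (cong (_+_ (toℕ (negW w))) (negatives-++ʷ p q)) (sym (+-assoc (toℕ (negW w)) _ _))
  negatives-++ʷ (bwd {w = w} _ p) q =
    trans (cong (_+_ (toℕ (negW w))) (negatives-++ʷ p q)) (sym (+-assoc (toℕ (negW w)) _ _))

  neg-++ʷ : ∀ {x y z} (p : Walk E x y) (q : Walk E y z) → neg (p ++ʷ q) ≡ neg p xor neg q
  neg-++ʷ []                q = refl
  neg-++ʷ (fwd {w = w} _ p) q =
    trans (cong (negW w xor_) (neg-++ʷ p q)) (sym (xor-assoc (negW w) _ _))
  neg-++ʷ (bwd {w = w} _ p) q =
    trans (cong (negW w xor_) (neg-++ʷ p q)) (sym (xor-assoc (negW w) _ _))

  odd-negatives : ∀ {x y} (p : Walk E x y) → odd (negatives p) ≡ neg p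
  odd-negatives []                = refl
  odd-negatives (fwd {w = w} _ p) =
    trans (odd-+ (toℕ (negW w)) _) (cong₂ _xor_ (odd-toℕ (negW w)) (odd-negatives p))
  odd-negatives (bwd {w = w} _ p) =
    trans (odd-+ (toℕ (negW w)) _) (cong₂ _xor_ (odd-toℕ (negW w)) (odd-negatives p))

module _ {n : ℕ} (E : WSG (Fin n)) where

  rung : Fin n → Edge (Fin n × Bool)
  rung x = (x , true) , (x , false) , -[1+ 0 ]

  rung∈EDC : ∀ x → rung x ∈ EDC E
  rung∈EDC x = ∈-++⁺ˡ (∈-map⁺ rung (∈-allFin x))

  ∈-EDC⁺ : ∀ {x y w a} → (x , y , w) ∈ E → a ∈ edcEdges (x , y , w) → a ∈ EDC E
  ∈-EDC⁺ e m = ∈-++⁺ʳ _ (∈-concatMap⁺ edcEdges (lose e m))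

  data EDC-Edge : Fin n × Bool → Fin n × Bool → ℤ → Set where
    vertical : ∀ {x} → EDC-Edge (x , true) (x , false) -[1+ 0 ]
    over     : ∀ {x y w w' b} → (x , y , w) ∈ E →
               ∣ w' ∣ ≡ toℕ (negW w') + ∣ w ∣ →
               EDC-Edge (x , b) (y , b xor (negW w xor negW w')) w'

  private
    -[+m+1]≡-[1+m] : ∀ m → ℤ.- (+ m ℤ.+ + 1) ≡ -[1+ m ]
    -[+m+1]≡-[1+m] m = cong (λ k → ℤ.- (+ k)) (+-comm m 1)

    -[1+m]-1≡-[2+m] : ∀ m → -[1+ m ] ℤ.- + 1 ≡ -[1+ suc m ]
    -[1+m]-1≡-[2+m] m = cong (λ k → -[1+ suc k ]) (+-identityʳ m)

  edcEdges-classify : ∀ {x y w u u' w'} → (x , y , w) ∈ E →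
    (u , u' , w') ∈ edcEdges (x , y , w) → EDC-Edge u u' w'
  edcEdges-classify {w = + m} e (here refl) = over e refl
  edcEdges-classify {w = + m} e (there (here refl)) = over e refl
  edcEdges-classify {w = + m} e (there (there (here refl)))
    rewrite -[+m+1]≡-[1+m] m = over e refl
  edcEdges-classify {w = + m} e (there (there (there (here refl))))
    rewrite -[+m+1]≡-[1+m] m = over e refl
  edcEdges-classify {w = -[1+ m ]} e (here refl) = over e refl
  edcEdges-classify {w = -[1+ m ]} e (there (here refl)) = over e refl
  edcEdges-classify {w = -[1+ m ]} e (there (there (here refl)))
    rewrite -[1+m]-1≡-[2+m] m = over e refl
  edcEdges-classify {w = -[1+ m ]} e (there (there (there (here refl))))
    rewrite -[1+m]-1≡-[2+m] m = over e refl

  EDC-classify : ∀ {u u' w'} → (u , u' , w') ∈ EDC E → EDC-Edge u u' w'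
  EDC-classify m with ∈-++⁻ (map rung (allFin n)) m
  ... | inj₁ m₁ with ∈-map⁻ rung m₁
  ...   | _ , _ , refl = vertical
  EDC-classify m | inj₂ m₂ with find (∈-concatMap⁻ edcEdges {xs = E} m₂)
  ...   | _ , e , m' = edcEdges-classify e m'

  record Shadow {x b y c} (q : Walk (EDC E) (x , b) (y , c)) : Set where
    field
      walk   : Walk E x y
      layer  : c ≡ b xor (neg walk xor neg q)
      length : len q ≡ negatives q + len walk

  open Shadow

  shadow-++ʷ : ∀ {x b y c z d}
    {q₁ : Walk (EDC E) (x , b) (y , c)} {q₂ : Walk (EDC E) (y , c) (z , d)} →
    Shadow q₁ → Shadow q₂ → Shadow (q₁ ++ʷ q₂)
  shadow-++ʷ {b = b} {c = c} {d = d} {q₁} {q₂} s₁ s₂ = record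
    { walk   = p₁ ++ʷ p₂
    ; layer  = begin
        d
          ≡⟨ layer s₂ ⟩
        c xor (neg p₂ xor neg q₂)
          ≡⟨ cong (_xor (neg p₂ xor neg q₂)) (layer s₁) ⟩
        (b xor (neg p₁ xor neg q₁)) xor (neg p₂ xor neg q₂)
          ≡⟨ xor-assoc b _ _ ⟩
        b xor ((neg p₁ xor neg q₁) xor (neg p₂ xor neg q₂))
          ≡⟨ cong (b xor_) (xor-interchange (neg p₁) (neg q₁) (neg p₂) (neg q₂)) ⟩
        b xor ((neg p₁ xor neg p₂) xor (neg q₁ xor neg q₂))
          ≡⟨ cong (b xor_) (sym (cong₂ _xor_ (neg-++ʷ p₁ p₂) (neg-++ʷ q₁ q₂))) ⟩
        b xor (neg (p₁ ++ʷ p₂) xor neg (q₁ ++ʷ q₂))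
          ∎
    ; length = begin
        len (q₁ ++ʷ q₂)
          ≡⟨ len-++ʷ q₁ q₂ ⟩
        len q₁ + len q₂
          ≡⟨ cong₂ _+_ (length s₁) (length s₂) ⟩
        (negatives q₁ + len p₁) + (negatives q₂ + len p₂)
          ≡⟨ +-interchange (negatives q₁) (len p₁) (negatives q₂) (len p₂) ⟩
        (negatives q₁ + negatives q₂) + (len p₁ + len p₂)
          ≡⟨ sym (cong₂ _+_ (negatives-++ʷ q₁ q₂) (len-++ʷ p₁ p₂)) ⟩
        negatives (q₁ ++ʷ q₂) + len (p₁ ++ʷ p₂)
          ∎
    }
    where
    open ≡-Reasoning
    p₁ = walk s₁
    p₂ = walk s₂

  shadow-[] : ∀ {x b} → Shadow {x} {b} []
  shadow-[] {b = b} = record { walk = [] ; layer = sym (xor-identityʳ b) ; length = refl }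

  shadow-fwd : ∀ {u u' w'} (m : (u , u' , w') ∈ EDC E) → EDC-Edge u u' w' →
    Shadow (fwd m [])
  shadow-fwd m vertical = record { walk = [] ; layer = refl ; length = refl }
  shadow-fwd m (over {w = w} {w'} {b} e abs) = record
    { walk   = fwd e []
    ; layer  = cong (b xor_) (sym t≡)
    ; length = begin
        ∣ w' ∣ + 0             ≡⟨ +-identityʳ ∣ w' ∣ ⟩
        ∣ w' ∣                 ≡⟨ abs ⟩
        k + ∣ w ∣              ≡⟨ cong₂ _+_ (+-identityʳ k) (+-identityʳ ∣ w ∣) ⟨
        (k + 0) + (∣ w ∣ + 0)  ∎
    }
    where
    open ≡-Reasoning
    k = toℕ (negW w')
    t≡ : (negW w xor false) xor (negW w' xor false) ≡ negW w xor negW w'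
    t≡ = cong₂ _xor_ (xor-identityʳ (negW w)) (xor-identityʳ (negW w'))

  shadow-bwd : ∀ {u u' w'} (m : (u , u' , w') ∈ EDC E) → EDC-Edge u u' w' →
    Shadow (bwd m [])
  shadow-bwd m vertical = record { walk = [] ; layer = refl ; length = refl }
  shadow-bwd m (over {w = w} {w'} {b} e abs) = record
    { walk   = bwd e []
    ; layer  = begin
        b                                                      ≡⟨ xor-cancelʳ b t ⟨
        (b xor t) xor t                                        ≡⟨ cong ((b xor t) xor_) t≡ ⟨
        (b xor t) xor ((negW w xor false) xor (negW w' xor false)) ∎
    ; length = length (shadow-fwd m (over e abs))
    }
    where
    open ≡-Reasoning
    t = negW w xor negW w'
    t≡ : (negW w xor false) xor (negW w' xor false) ≡ t
    t≡ = cong₂ _xor_ (xor-identityʳ (negW w)) (xor-identityʳ (negW w'))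

  shadow : ∀ {x b y c} (q : Walk (EDC E) (x , b) (y , c)) → Shadow q
  shadow []        = shadow-[]
  shadow (fwd m q) = shadow-++ʷ (shadow-fwd m (EDC-classify m)) (shadow q)
  shadow (bwd m q) = shadow-++ʷ (shadow-bwd m (EDC-classify m)) (shadow q)

  edge-lift : ∀ {x y w b c} → (x , y , w) ∈ E → c ≡ b xor negW w →
    Σ[ w' ∈ ℤ ] ((x , b) , (y , c) , w') ∈ EDC E × ∣ w' ∣ ≡ ∣ w ∣ ×
                negW w' ≡ false
  edge-lift {w = + _}     {b = true}  e refl = _ , ∈-EDC⁺ e (here refl) , refl , refl
  edge-lift {w = + _}     {b = false} e refl = _ , ∈-EDC⁺ e (there (here refl)) , refl , refl
  edge-lift {w = -[1+ _ ]} {b = true}  e refl = _ , ∈-EDC⁺ e (here refl) , refl , refl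
  edge-lift {w = -[1+ _ ]} {b = false} e refl = _ , ∈-EDC⁺ e (there (here refl)) , refl , refl

  lift : ∀ {x y b c} (p : Walk E x y) → c ≡ b xor neg p →
    Σ[ q ∈ Walk (EDC E) (x , b) (y , c) ] len q ≡ len p × neg q ≡ false
  lift {b = false} [] refl = [] , refl , refl
  lift {b = true}  [] refl = [] , refl , refl
  lift {b = b} (fwd {w = w} e p) eq =
    let _ , m , abs , pos = edge-lift e refl
        q , lq , nq = lift p (trans eq (sym (xor-assoc b (negW w) (neg p))))
    in fwd m q , cong₂ _+_ abs lq , cong₂ _xor_ pos nq
  lift {b = b} (bwd {w = w} e p) eq =
    let _ , m , abs , pos = edge-lift {b = b xor negW w} e (sym (xor-cancelʳ b (negW w)))
        q , lq , nq = lift p (trans eq (sym (xor-assoc b (negW w) (neg p))))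
    in bwd m q , cong₂ _+_ abs lq , cong₂ _xor_ pos nq

  lift-closed : ∀ {x} (p : Walk E x x) →
    Σ[ q ∈ Walk (EDC E) (x , false) (x , false) ]
      len q ≡ toℕ (neg p) + len p × neg q ≡ neg p
  lift-closed p with neg p in neg-p
  ... | false = lift p (sym neg-p)
  ... | true  = let q , lq , nq = lift {b = true} p (cong not (sym neg-p))
                in bwd (rung∈EDC _) q , cong suc lq , cong not nq

  lift-typed : ∀ {s j x} (p : Walk E x x) → type p ≡ (s , j) →
    Σ[ q ∈ Walk (EDC E) (x , false) (x , false) ]
      type q ≡ (s , j xor s) × len q ≡ toℕ s + len p
  lift-typed p refl =
    let q , lq , nq = lift-closed p
        odd-len-q = trans (cong odd lq) (odd-shift (toℕ (neg p)) (len p) (odd-toℕ (neg p)))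
    in q , cong₂ _,_ nq odd-len-q , lq

  project-typed : ∀ {s j x b} (q : Walk (EDC E) (x , b) (x , b)) → type q ≡ (s , j xor s) →
    Σ[ p ∈ Walk E x x ] type p ≡ (s , j) × toℕ s + len p ≤ len q
  project-typed {s} {j} q tq = p , cong₂ _,_ neg-p odd-len-p , bound
    where
    sh = shadow q
    p = walk sh
    neg-q : neg q ≡ s
    neg-q = cong proj₁ tq
    odd-negatives-q : odd (negatives q) ≡ s
    odd-negatives-q = trans (odd-negatives q) neg-q
    neg-p : neg p ≡ s
    neg-p = trans (xor≡false⇒≡ (xor-identityʳ-unique _ (layer sh))) neg-q
    odd-len-p : odd (len p) ≡ j
    odd-len-p = xor-injectiveˡ s (begin
      odd (len p) xor s            ≡⟨ odd-shift (negatives q) (len p) odd-negatives-q ⟨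
      odd (negatives q + len p)    ≡⟨ cong odd (length sh) ⟨
      odd (len q)                  ≡⟨ cong proj₂ tq ⟩
      j xor s                      ∎)
      where open ≡-Reasoning
    bound : toℕ s + len p ≤ len q
    bound = ≤-trans (+-monoˡ-≤ (len p) (odd⇒toℕ≤ odd-negatives-q))
                    (≤-reflexive (sym (length sh)))

  -- The shift is written toℕ s + m so that it reduces to m or suc m.
  transfer : ∀ s j v →
    IsG E (s , j) v ⇔ IsG (EDC E) (s , j xor s) (Maybe.map (_+_ (toℕ s)) v)
  transfer s j nothing = mk⇔
    (λ none u q tq → let p , tp , _ = project-typed q tq in none _ p tp)
    (λ none x p tp → let q , tq , _ = lift-typed p tp in none _ q tq)
  transfer s j (just m) = mk⇔ to from
    where
    to : IsG E (s , j) (just m) → IsG (EDC E) (s , j xor s) (just (toℕ s + m))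
    to ((x , p , tp , refl) , least) =
      let q , tq , lq = lift-typed p tp
      in ((x , false) , q , tq , lq) ,
         λ u q' tq' → let p' , tp' , bound = project-typed q' tq'
                      in ≤-trans (+-monoʳ-≤ (toℕ s) (least _ p' tp')) bound
    from : IsG (EDC E) (s , j xor s) (just (toℕ s + m)) → IsG E (s , j) (just m)
    from ((u , q , tq , lq) , least) with project-typed q tq
    ... | p , tp , bound = (proj₁ u , p , tp , ≤-antisym len-p≤m (least′ _ p tp)) , least′
      where
      len-p≤m : len p ≤ m
      len-p≤m = +-cancelˡ-≤ (toℕ s) _ _ (≤-trans bound (≤-reflexive lq))
      least′ : ∀ x (p : Walk E x x) → type p ≡ (s , j) → m ≤ len p
      least′ x p tp = let q′ , tq′ , lq′ = lift-typed p tp in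
        +-cancelˡ-≤ (toℕ s) _ _ (≤-trans (least _ q′ tq′) (≤-reflexive lq′))

lemma3 : (n : ℕ) (E : WSG (Fin n)) → ValidWeights E → (v : Maybe ℕ) →
    (IsG E (false , true) v ⇔ IsG (EDC E) (false , true) v)
    × (IsG E (true , true) v ⇔ IsG (EDC E) (true , false) (suc∞ v))
    × (IsG E (true , false) v ⇔ IsG (EDC E) (true , true) (suc∞ v))
lemma3 n E _ (just m) =
  transfer E false true (just m) , transfer E true true (just m) , transfer E true false (just m)
lemma3 n E _ nothing =
  transfer E false true nothing , transfer E true true nothing , transfer E true false nothing
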